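{- Let $(\mathcal{C},\mathcal{M})$ be an AECat with the amalgamation property, let $\mathop{\perp\!\!\!\perp}$ be a basic independence relation, and suppose $a\mathop{\perp\!\!\!\perp}_c^Mb$. Then for any arrow $d$ into $M$ there are an extension $M\to N$ and an arrow $d':\mathrm{dom}(d)\to N$ such that $\mathrm{Lgtp}(d'/b,c;N)=\mathrm{Lgtp}(d/b,c;N)$ and $a\mathop{\perp\!\!\!\perp}_c^Nd'$.
   Context: An AECat is a pair $(\mathcal{C},\mathcal{M})$ of accessible categories with $\mathcal{M}$ a full subcategory of $\mathcal{C}$, $\mathcal{M}$ having directed colimits preserved by the inclusion, and every arrow of $\mathcal{C}$ a monomorphism; objects of $\mathcal{M}$ are models. AP: every span of models completes to a commutative square into a model. An extension of a model $M$ is an arrow $M\to N$ with $N$ a model; given it and $a:A\to M$ we also write $a$ for $A\to M\to N$, and subobjects of $M$ are regarded as subobjects of $N$. $\mathrm{gtp}((a_i)_i;M)=\mathrm{gtp}((a_i')_i;M')$ means $\mathrm{dom}(a_i)=\mathrm{dom}(a_i')$ and there are extensions $f:M\to N$, $f':M'\to N$ with $fa_i=f'a_i'$ for all $i$. $(d/(b_j)_j;M)\sim(d'/(b_j)_j;M)$ if there are an extension $M\to N$ and $m_0:M_0\to N$ with $M_0$ a model, each $b_j$ factoring through $m_0$, and $\mathrm{gtp}(d,m_0;N)=\mathrm{gtp}(d',m_0;N)$; its transitive closure is written $\mathrm{Lgtp}(d/(b_j)_j;M)=\mathrm{Lgtp}(d'/(b_j)_j;M)$, and $\mathrm{Lgtp}(d/b,c;N)$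 refers to the tuple $(b,c)$. An independence relation is a relation on triples of subobjects of a model $M$, written $X\mathop{\perp\!\!\!\perp}_Z^MY$ (arrows may replace the subobjects they represent), with a base class (a collection of objects containing all models) containing the domain of $Z$ whenever $X\mathop{\perp\!\!\!\perp}_Z^MY$. Basic means: Invariance ($a\mathop{\perp\!\!\!\perp}_c^Mb$, $\mathrm{gtp}(a,b,c;M)=\mathrm{gtp}(a',b',c';M')$ imply $a'\mathop{\perp\!\!\!\perp}_{c'}^{M'}b'$); Monotonicity ($X\mathop{\perp\!\!\!\perp}_Z^MY$, $X'\le X$ imply $X'\mathop{\perp\!\!\!\perp}_Z^MY$); Transitivity ($X\mathop{\perp\!\!\!\perp}_B^MC$, $X\mathop{\perp\!\!\!\perp}_C^MD$, $B\le C$ imply $X\mathop{\perp\!\!\!\perp}_B^MD$); Symmetry; Existence ($X\mathop{\perp\!\!\!\perp}_Z^MZ$ for $Z$ with domain in the base class); Extension (if $a\mathop{\perp\!\!\!\perp}_c^Mb$ and $b$ factors through $b':B'\to M$, there are an extension $M\to N$ and $a':\mathrm{dom}(a)\to N$ with $\mathrm{gtp}(a',b,c;N)=\mathrm{gtp}(a,b,c;M)$, $a'\mathop{\perp\!\!\!\perp}_c^Nb'$); Union (if $(B_i)_{i\in I}$ is directed with a cocone into a model $M$ and $B=\mathrm{colim}_iB_i$ exists, $X\mathop{\perp\!\!\!\perp}_Z^MB_i$ for all $i$ implies $X\mathop{\perp\!\!\!\perp}_Z^MB$). -}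

module Defs where

open import Level using (Level; _⊔_; Lift) renaming (suc to lsuc)
open import Data.Nat using (ℕ)
open import Data.Fin using (Fin; zero; suc)
open import Data.Product using (Σ; _×_; _,_; proj₁; proj₂; ∃-syntax)
open import Relation.Nullary using (¬_)
open import Relation.Binary using (Rel; IsEquivalence)
open import Relation.Binary.Construct.Closure.Transitive using (TransClosure)
open import Function.Bundles using (_↣_)

record Category (o ℓ e : Level) : Set (lsuc (o ⊔ ℓ ⊔ e)) where
  infixr 9 _∘_
  infix  4 _≈_
  field
    Obj      : Set o
    _⇒_      : Obj → Obj → Set ℓ
    _≈_      : ∀ {A B} → Rel (A ⇒ B) e
    id       : ∀ {A} → A ⇒ A
    _∘_      : ∀ {A B C} → B ⇒ C → A ⇒ B → A ⇒ C
    ≈-equiv  : ∀ {A B} → IsEquivalence (_≈_ {A} {B})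
    ∘-resp-≈ : ∀ {A B C} {f f′ : B ⇒ C} {g g′ : A ⇒ B} →
               f ≈ f′ → g ≈ g′ → f ∘ g ≈ f′ ∘ g′
    assoc    : ∀ {A B C D} {f : A ⇒ B} {g : B ⇒ C} {h : C ⇒ D} →
               (h ∘ g) ∘ f ≈ h ∘ (g ∘ f)
    identityˡ : ∀ {A B} {f : A ⇒ B} → id ∘ f ≈ f
    identityʳ : ∀ {A B} {f : A ⇒ B} → f ∘ id ≈ f

-- A regular (infinite) cardinal λ, presented by the class of index types
-- of size < λ (types living in Set ι).

record RegularCardinal (ι : Level) : Set (lsuc ι) where
  field
    Small     : Set ι → Set ι
    -- λ is infinite: all finite types are small
    fin-small : ∀ n → Small (Lift ι (Fin n))
    inj-small : ∀ {X Y : Set ι} → (X ↣ Y) → Small Y → Small X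
    -- regularity: a small union of small sets is small
    Σ-small   : ∀ {K : Set ι} {F : K → Set ι} →
                Small K → (∀ k → Small (F k)) → Small (Σ K F)
    -- λ is a genuine (set-sized) cardinal: some type is not small
    bounded   : Σ (Set ι) (λ X → ¬ Small X)

record Preorder′ (ι : Level) : Set (lsuc ι) where
  field
    Carrier : Set ι
    _≤_     : Carrier → Carrier → Set ι
    ≤-refl  : ∀ {i} → i ≤ i
    ≤-trans : ∀ {i j k} → i ≤ j → j ≤ k → i ≤ k

IsλDirected : ∀ {ι} → RegularCardinal ι → Preorder′ ι → Set (lsuc ι)
IsλDirected {ι} λ′ P = ∀ (K : Set ι) → Small K → (f : K → Carrier) →
                         Σ Carrier (λ u → ∀ k → f k ≤ u)
  where open RegularCardinal λ′ ; open Preorder′ P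

IsDirected : ∀ {ι} → Preorder′ ι → Set ι
IsDirected P = ∀ (n : ℕ) → (f : Fin n → Carrier) →
                 Σ Carrier (λ u → ∀ k → f k ≤ u)
  where open Preorder′ P

module CatNotions {o ℓ e : Level} (C : Category o ℓ e) where
  open Category C

  Mono : ∀ {A B} → A ⇒ B → Set (o ⊔ ℓ ⊔ e)
  Mono {A} f = ∀ {X} (g h : X ⇒ A) → f ∘ g ≈ f ∘ h → g ≈ h

  record Iso (A B : Obj) : Set (ℓ ⊔ e) where
    field
      to   : A ⇒ B
      from : B ⇒ A
      isoˡ : from ∘ to ≈ id
      isoʳ : to ∘ from ≈ id

  _≤ₛ_ : ∀ {X X′ M} → X ⇒ M → X′ ⇒ M → Set (ℓ ⊔ e)
  _≤ₛ_ {X} {X′} x x′ = Σ (X ⇒ X′) (λ h → x′ ∘ h ≈ x)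

  _≅ₛ_ : ∀ {X X′ M} → X ⇒ M → X′ ⇒ M → Set (ℓ ⊔ e)
  x ≅ₛ x′ = (x ≤ₛ x′) × (x′ ≤ₛ x)

  dom : ∀ {A B} → A ⇒ B → Obj
  dom {A} _ = A

  record Diagram {ι : Level} (P : Preorder′ ι) : Set (o ⊔ ℓ ⊔ e ⊔ ι) where
    open Preorder′ P
    field
      D      : Carrier → Obj
      map    : ∀ {i j} → i ≤ j → D i ⇒ D j
      thin   : ∀ {i j} (p q : i ≤ j) → map p ≈ map q
      map-id : ∀ {i} → map (≤-refl {i}) ≈ id
      map-∘  : ∀ {i j k} (p : i ≤ j) (q : j ≤ k) →
               map (≤-trans p q) ≈ map q ∘ map p

  record Cocone {ι : Level} {P : Preorder′ ι} (F : Diagram P)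
                : Set (o ⊔ ℓ ⊔ e ⊔ ι) where
    open Preorder′ P
    open Diagram F
    field
      apex    : Obj
      leg     : ∀ i → D i ⇒ apex
      commute : ∀ {i j} (p : i ≤ j) → leg j ∘ map p ≈ leg i

  IsColimit : ∀ {ι} {P : Preorder′ ι} {F : Diagram P} → Cocone F →
              Set (o ⊔ ℓ ⊔ e ⊔ ι)
  IsColimit {P = P} {F} K =
    ∀ (K′ : Cocone F) →
      Σ (apex K ⇒ apex K′) (λ u →
        (∀ i → u ∘ leg K i ≈ leg K′ i) ×
        (∀ (v : apex K ⇒ apex K′) → (∀ i → v ∘ leg K i ≈ leg K′ i) → v ≈ u))
    where open Cocone

  record Colimit {ι} {P : Preorder′ ι} (F : Diagram P) : Set (o ⊔ ℓ ⊔ e ⊔ ι) where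
    field
      cocone    : Cocone F
      universal : IsColimit cocone

  HasλDirectedColimits : ∀ {ι} → RegularCardinal ι → Set (o ⊔ ℓ ⊔ e ⊔ lsuc ι)
  HasλDirectedColimits {ι} λ′ =
    ∀ (P : Preorder′ ι) → IsλDirected λ′ P → (F : Diagram P) → Colimit F

  -- A is λ-presentable: hom(A,-) preserves λ-directed colimits
  IsλPresentable : ∀ {ι} → RegularCardinal ι → Obj → Set (o ⊔ ℓ ⊔ e ⊔ lsuc ι)
  IsλPresentable {ι} λ′ A =
    ∀ (P : Preorder′ ι) → IsλDirected λ′ P → (F : Diagram P)
      (K : Cocone F) → IsColimit K →
      (∀ (f : A ⇒ Cocone.apex K) →
          Σ (Preorder′.Carrier P) (λ i → Σ (A ⇒ Diagram.D F i) (λ g →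
            Cocone.leg K i ∘ g ≈ f)))
      ×
      (∀ {i j} (g : A ⇒ Diagram.D F i) (h : A ⇒ Diagram.D F j) →
          Cocone.leg K i ∘ g ≈ Cocone.leg K j ∘ h →
          Σ (Preorder′.Carrier P) (λ k →
            Σ (Preorder′._≤_ P i k) (λ p → Σ (Preorder′._≤_ P j k) (λ q →
              Diagram.map F p ∘ g ≈ Diagram.map F q ∘ h))))

  record IsAccessible (ι : Level) : Set (o ⊔ ℓ ⊔ e ⊔ lsuc ι) where
    field
      λ′          : RegularCardinal ι
      colimits    : HasλDirectedColimits λ′
      Gen         : Set ι
      gen         : Gen → Obj
      presentable : ∀ g → IsλPresentable λ′ (gen g)
      generated   : ∀ (X : Obj) →
        Σ (Preorder′ ι) (λ P → IsλDirected λ′ P × Σ (Diagram P) (λ F →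
          ((∀ i → Σ Gen (λ g → Iso (Diagram.D F i) (gen g)))) ×
          Σ (Cocone F) (λ K → IsColimit K × Iso (Cocone.apex K) X)))

FullSub : ∀ {o ℓ e m} (C : Category o ℓ e) → (Category.Obj C → Set m) →
          Category (o ⊔ m) ℓ e
FullSub C P = record
  { Obj = Σ Obj P
  ; _⇒_ = λ A B → proj₁ A ⇒ proj₁ B
  ; _≈_ = _≈_
  ; id = id
  ; _∘_ = _∘_
  ; ≈-equiv = ≈-equiv
  ; ∘-resp-≈ = ∘-resp-≈
  ; assoc = assoc
  ; identityˡ = identityˡ
  ; identityʳ = identityʳ
  }
  where open Category C

module AEC {o ℓ e m : Level} (C : Category o ℓ e)
           (IsModel : Category.Obj C → Set m) where
  open Category C
  open CatNotions C
  𝓜 : Category (o ⊔ m) ℓ e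
  𝓜 = FullSub C IsModel
  module M = CatNotions 𝓜

  inclD : ∀ {ι} {P : Preorder′ ι} → M.Diagram P → Diagram P
  inclD F = record
    { D = λ i → proj₁ (M.Diagram.D F i)
    ; map = M.Diagram.map F
    ; thin = M.Diagram.thin F
    ; map-id = M.Diagram.map-id F
    ; map-∘ = M.Diagram.map-∘ F }

  inclK : ∀ {ι} {P : Preorder′ ι} {F : M.Diagram P} → M.Cocone F →
          Cocone (inclD F)
  inclK K = record
    { apex = proj₁ (M.Cocone.apex K)
    ; leg = M.Cocone.leg K
    ; commute = M.Cocone.commute K }

  record IsAECat (ι : Level) : Set (o ⊔ ℓ ⊔ e ⊔ m ⊔ lsuc ι) where
    field
      C-accessible : IsAccessible ι
      M-accessible : M.IsAccessible ι
      M-directed-colimits :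
        ∀ (P : Preorder′ ι) → IsDirected P → (F : M.Diagram P) →
          Σ (M.Cocone F) (λ K → M.IsColimit K × IsColimit (inclK K))
      all-mono : ∀ {A B} (f : A ⇒ B) → Mono f

  AP : Set (o ⊔ ℓ ⊔ e ⊔ m)
  AP = ∀ {M₀ M₁ M₂} → IsModel M₀ → IsModel M₁ → IsModel M₂ →
       (f₁ : M₀ ⇒ M₁) (f₂ : M₀ ⇒ M₂) →
       Σ Obj (λ N → IsModel N × Σ (M₁ ⇒ N) (λ g₁ → Σ (M₂ ⇒ N) (λ g₂ →
         g₁ ∘ f₁ ≈ g₂ ∘ f₂)))

  Tuple : ∀ {n} → (Fin n → Obj) → Obj → Set ℓ
  Tuple {n} doms M = (i : Fin n) → doms i ⇒ M

  _·_ : ∀ {n} {doms : Fin n → Obj} {M N} → M ⇒ N → Tuple doms M → Tuple doms N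
  (f · t) i = f ∘ t i

  GtpEq : ∀ {n} {doms : Fin n → Obj} {M M′} →
          Tuple doms M → Tuple doms M′ → Set (o ⊔ ℓ ⊔ e ⊔ m)
  GtpEq {M = M} {M′} a a′ =
    Σ Obj (λ N → IsModel N × Σ (M ⇒ N) (λ f → Σ (M′ ⇒ N) (λ f′ →
      ∀ i → f ∘ a i ≈ f′ ∘ a′ i)))

  doms2 : Obj → Obj → Fin 2 → Obj
  doms2 A B zero = A
  doms2 A B (suc _) = B

  tup2 : ∀ {A B M} → A ⇒ M → B ⇒ M → Tuple (doms2 A B) M
  tup2 a b zero = a
  tup2 a b (suc _) = b

  doms3 : Obj → Obj → Obj → Fin 3 → Obj
  doms3 A B C′ zero = A
  doms3 A B C′ (suc zero) = B
  doms3 A B C′ (suc (suc _)) = C′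

  tup3 : ∀ {A B C′ M} → A ⇒ M → B ⇒ M → C′ ⇒ M → Tuple (doms3 A B C′) M
  tup3 a b c zero = a
  tup3 a b c (suc zero) = b
  tup3 a b c (suc (suc _)) = c

  LgtpStep : ∀ {n} {doms : Fin n → Obj} {M D} → Tuple doms M →
             Rel (D ⇒ M) (o ⊔ ℓ ⊔ e ⊔ m)
  LgtpStep {doms = doms} {M} {D} bs d d′ =
    Σ Obj (λ N → IsModel N × Σ (M ⇒ N) (λ f →
      Σ Obj (λ M₀ → IsModel M₀ × Σ (M₀ ⇒ N) (λ m₀ →
        (∀ j → (f ∘ bs j) ≤ₛ m₀) ×
        GtpEq {doms = doms2 D M₀} (tup2 (f ∘ d) m₀) (tup2 (f ∘ d′) m₀)))))

  LgtpEq : ∀ {n} {doms : Fin n → Obj} {M D} → Tuple doms M →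
           Rel (D ⇒ M) (o ⊔ ℓ ⊔ e ⊔ m)
  LgtpEq bs = TransClosure (LgtpStep bs)

  -- an independence relation: Ind x z y stands for  x ⫫_z^M y
  IndRel : (r : Level) → Set (o ⊔ ℓ ⊔ lsuc r)
  IndRel r = ∀ {X Z Y M} → X ⇒ M → Z ⇒ M → Y ⇒ M → Set r

  record IsIndependenceRelation {r b : Level} (Ind : IndRel r)
         (Base : Obj → Set b) : Set (o ⊔ ℓ ⊔ e ⊔ m ⊔ r ⊔ b) where
    field
      on-subobjects : ∀ {X X′ Z Z′ Y Y′ M} → IsModel M →
        {x : X ⇒ M} {x′ : X′ ⇒ M} {z : Z ⇒ M} {z′ : Z′ ⇒ M}
        {y : Y ⇒ M} {y′ : Y′ ⇒ M} →
        x ≅ₛ x′ → z ≅ₛ z′ → y ≅ₛ y′ → Ind x z y → Ind x′ z′ y′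
      models-in-base : ∀ {M} → IsModel M → Base M
      base-in-base : ∀ {X Z Y M} → IsModel M →
        (x : X ⇒ M) (z : Z ⇒ M) (y : Y ⇒ M) → Ind x z y → Base Z

  record IsBasic (ι : Level) {r b : Level} (Ind : IndRel r) (Base : Obj → Set b)
         : Set (o ⊔ ℓ ⊔ e ⊔ m ⊔ r ⊔ b ⊔ lsuc ι) where
    field
      isIndependence : IsIndependenceRelation Ind Base
      invariance : ∀ {A B C′ M M′} → IsModel M → IsModel M′ →
        (a : A ⇒ M) (b : B ⇒ M) (c : C′ ⇒ M)
        (a′ : A ⇒ M′) (b′ : B ⇒ M′) (c′ : C′ ⇒ M′) →
        Ind a c b → GtpEq (tup3 a b c) (tup3 a′ b′ c′) → Ind a′ c′ b′
      monotonicity : ∀ {X X′ Z Y M} → IsModel M →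
        (x : X ⇒ M) (x′ : X′ ⇒ M) (z : Z ⇒ M) (y : Y ⇒ M) →
        Ind x z y → x′ ≤ₛ x → Ind x′ z y
      transitivity : ∀ {X B C′ D M} → IsModel M →
        (x : X ⇒ M) (b : B ⇒ M) (c : C′ ⇒ M) (d : D ⇒ M) →
        Ind x b c → Ind x c d → b ≤ₛ c → Ind x b d
      symmetry : ∀ {X Z Y M} → IsModel M →
        (x : X ⇒ M) (z : Z ⇒ M) (y : Y ⇒ M) → Ind x z y → Ind y z x
      existence : ∀ {X Z M} → IsModel M →
        (x : X ⇒ M) (z : Z ⇒ M) → Base Z → Ind x z z
      extension : ∀ {A B B′ C′ M} → IsModel M →
        (a : A ⇒ M) (b : B ⇒ M) (c : C′ ⇒ M) (b′ : B′ ⇒ M) →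
        Ind a c b → b ≤ₛ b′ →
        Σ Obj (λ N → IsModel N × Σ (M ⇒ N) (λ f → Σ (A ⇒ N) (λ a′ →
          GtpEq (tup3 a′ (f ∘ b) (f ∘ c)) (tup3 a b c) ×
          Ind a′ (f ∘ c) (f ∘ b′))))
      union : ∀ {X Z M} → IsModel M →
        (P : Preorder′ ι) → IsDirected P → (F : Diagram P) →
        (bs : ∀ i → Diagram.D F i ⇒ M) →
        (∀ {i j} (p : Preorder′._≤_ P i j) → bs j ∘ Diagram.map F p ≈ bs i) →
        (L : Colimit F) → (bL : Cocone.apex (Colimit.cocone L) ⇒ M) →
        (∀ i → bL ∘ Cocone.leg (Colimit.cocone L) i ≈ bs i) →
        (x : X ⇒ M) (z : Z ⇒ M) →
        (∀ i → Ind x z (bs i)) → Ind x z bL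

-- Extending a ⫫_c b to a ⫫_c M and amalgamating along the resulting type equality gives two
-- embeddings g, h of M into a model, agreeing on b and c, with h(a) ⫫_{h(c)} g(M). Applying this
-- once more to h(a) ⫫_{h(c)} g(M) makes the image of a independent over c from a whole second
-- copy of M, in particular from the copy d′ of d. Over the model g(M), d′ and the image of d have
-- the same type: they come from two embeddings that agree on g(M), and amalgamating those over
-- their common domain identifies them.
module Submission where

open import Defs
open import Level using (Level)
open import Data.Product using (Σ; _×_; _,_)
open import Data.Fin using (zero; suc)
open import Relation.Binary using (IsEquivalence)
open import Relation.Binary.Construct.Closure.Transitive using ([_])

module HomEquality {o ℓ e : Level} (C : Category o ℓ e) where
  open Category C

  open module ≈ {A B} = IsEquivalence (≈-equiv {A} {B}) public
    using () renaming (refl to ≈-refl; sym to ≈-sym; trans to ≈-trans)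

  ∘-congˡ : ∀ {X Y Z} (h : Y ⇒ Z) {x y : X ⇒ Y} → x ≈ y → h ∘ x ≈ h ∘ y
  ∘-congˡ h p = ∘-resp-≈ ≈-refl p

  ∘-congʳ : ∀ {X Y Z} {g h : Y ⇒ Z} (x : X ⇒ Y) → g ≈ h → g ∘ x ≈ h ∘ x
  ∘-congʳ x p = ∘-resp-≈ p ≈-refl

module LocalTypes {o ℓ e m : Level} (C : Category o ℓ e)
                  (IsModel : Category.Obj C → Set m) where
  open Category C
  open AEC C IsModel
  open CatNotions C
  open HomEquality C

  LgtpStep-respʳ : ∀ {n} {doms} {M D} {bs : Tuple {n} doms M} {d d′ d″ : D ⇒ M} →
                   d′ ≈ d″ → LgtpStep bs d d′ → LgtpStep bs d d″
  LgtpStep-respʳ d′≈d″ (N , N-model , f , M₀ , M₀-model , m₀ , factor ,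
                        (P , P-model , u , v , same)) =
    N , N-model , f , M₀ , M₀-model , m₀ , factor ,
    (P , P-model , u , v , λ { zero    → ≈-trans (same zero)
                                           (∘-congˡ v (∘-congˡ f d′≈d″))
                             ; (suc i) → same (suc i) })

  module _ (ap : AP) where

    -- Amalgamating u and v over N₁ identifies u ∘ x with v ∘ x while fixing v ∘ m ≈ u ∘ m.
    LgtpStep-of-agreeing-embeddings :
      ∀ {n} {doms} {N₁ N₂ M₀ D} → IsModel N₁ → IsModel N₂ → IsModel M₀ →
      (u v : N₁ ⇒ N₂) (m : M₀ ⇒ N₁) → u ∘ m ≈ v ∘ m →
      (bs : Tuple {n} doms N₂) → (∀ j → bs j ≤ₛ (v ∘ m)) →
      (x : D ⇒ N₁) → LgtpStep bs (u ∘ x) (v ∘ x)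
    LgtpStep-of-agreeing-embeddings {N₁ = N₁} {N₂} {M₀} N₁-model N₂-model M₀-model
                                    u v m um≈vm bs factor x
      with ap N₁-model N₂-model N₂-model u v
    ... | Q , Q-model , q , q′ , qu≈q′v =
      N₂ , N₂-model , id , M₀ , M₀-model , v ∘ m ,
      (λ j → let (w , vmw≈b) = factor j in w , ≈-trans vmw≈b (≈-sym identityˡ)) ,
      (Q , Q-model , q , q′ ,
        λ { zero    → ≈-trans (∘-congˡ q identityˡ)
                        (≈-trans (amalgamated x) (∘-congˡ q′ (≈-sym identityˡ)))
          ; (suc _) → ≈-trans (∘-congˡ q (≈-sym um≈vm)) (amalgamated m) })
      where
      amalgamated : ∀ {Y} (y : Y ⇒ N₁) → q ∘ (u ∘ y) ≈ q′ ∘ (v ∘ y)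
      amalgamated y = ≈-trans (≈-sym assoc) (≈-trans (∘-congʳ y qu≈q′v) assoc)

module BasicIndependence {o ℓ e m ι r b : Level} (C : Category o ℓ e)
                         (IsModel : Category.Obj C → Set m)
                         {Ind : AEC.IndRel C IsModel r} {Base : Category.Obj C → Set b}
                         (basic : AEC.IsBasic C IsModel ι Ind Base) where
  open Category C
  open AEC C IsModel
  open CatNotions C
  open HomEquality C
  open IsBasic basic
  open IsIndependenceRelation isIndependence

  Ind-resp-≈ : ∀ {X Z Y M} → IsModel M → {x x′ : X ⇒ M} {z z′ : Z ⇒ M} {y y′ : Y ⇒ M} →
               x ≈ x′ → z ≈ z′ → y ≈ y′ → Ind x z y → Ind x′ z′ y′
  Ind-resp-≈ M-model x≈x′ z≈z′ y≈y′ =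
    on-subobjects M-model (same-subobject x≈x′) (same-subobject z≈z′) (same-subobject y≈y′)
    where
    same-subobject : ∀ {X M} {x x′ : X ⇒ M} → x ≈ x′ → x ≅ₛ x′
    same-subobject p = (id , ≈-trans identityʳ (≈-sym p)) , (id , ≈-trans identityʳ p)

  Ind-∘ : ∀ {X Z Y P Q} → IsModel P → IsModel Q → (g : P ⇒ Q)
          {x : X ⇒ P} {z : Z ⇒ P} {y : Y ⇒ P} → Ind x z y → Ind (g ∘ x) (g ∘ z) (g ∘ y)
  Ind-∘ {Q = Q} P-model Q-model g {x} {z} {y} x⫫y =
    invariance P-model Q-model x y z (g ∘ x) (g ∘ y) (g ∘ z) x⫫y
      (Q , Q-model , g , id , λ { zero          → ≈-sym identityˡ
                                ; (suc zero)    → ≈-sym identityˡ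
                                ; (suc (suc _)) → ≈-sym identityˡ })

  Ind-monoʳ : ∀ {X Z Y Y′ M} → IsModel M → {x : X ⇒ M} {z : Z ⇒ M} {y : Y ⇒ M} {y′ : Y′ ⇒ M} →
              Ind x z y → y′ ≤ₛ y → Ind x z y′
  Ind-monoʳ M-model {x} {z} {y} {y′} x⫫y y′≤y =
    symmetry M-model y′ z x (monotonicity M-model y y′ z x (symmetry M-model x z y x⫫y) y′≤y)

  -- Extension with the whole model as the larger set, then amalgamation along the type equality.
  independent-embedding :
    ∀ {A B C′ M} → IsModel M → (a : A ⇒ M) (b : B ⇒ M) (c : C′ ⇒ M) → Ind a c b →
    Σ Obj (λ N → IsModel N × Σ (M ⇒ N) (λ g → Σ (M ⇒ N) (λ h →
      h ∘ b ≈ g ∘ b × h ∘ c ≈ g ∘ c × Ind (h ∘ a) (h ∘ c) g)))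
  independent-embedding M-model a b c a⫫b
    with extension M-model a b c id a⫫b (b , identityˡ)
  ... | N , N-model , f , a′ , (N′ , N′-model , g , h , same) , a′⫫M =
    N′ , N′-model , g ∘ f , h ,
    ≈-trans (≈-sym (same (suc zero))) (≈-sym assoc) ,
    ≈-trans (≈-sym (same (suc (suc zero)))) (≈-sym assoc) ,
    Ind-resp-≈ N′-model (same zero) (same (suc (suc zero))) (∘-congˡ g identityʳ)
      (Ind-∘ N-model N′-model g a′⫫M)

proposition4p12 : ∀ {o ℓ e m ι r b : Level} (C : Category o ℓ e)
    (IsModel : Category.Obj C → Set m) →
    let open Category C in
    let open AEC C IsModel in
    IsAECat ι → AP →
    (Ind : IndRel r) (Base : Obj → Set b) → IsBasic ι Ind Base →
    ∀ {A B C′ D M} → IsModel M →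
    (a : A ⇒ M) (b : B ⇒ M) (c : C′ ⇒ M) → Ind a c b →
    (d : D ⇒ M) →
    Σ Obj (λ N → IsModel N × Σ (M ⇒ N) (λ f → Σ (D ⇒ N) (λ d′ →
      LgtpEq (tup2 (f ∘ b) (f ∘ c)) d′ (f ∘ d) ×
      Ind (f ∘ a) (f ∘ c) d′)))
proposition4p12 C IsModel _ ap _ _ basic M-model a b c a⫫b d =
  let open Category C
      open HomEquality C
      open LocalTypes C IsModel
      open BasicIndependence C IsModel basic
      N₁ , N₁-model , g₁ , h₁ , h₁b≈g₁b , h₁c≈g₁c , h₁a⫫g₁ =
        independent-embedding M-model a b c a⫫b
      N₂ , N₂-model , g₂ , h₂ , h₂g₁≈g₂g₁ , _ , h₂h₁a⫫g₂ =
        independent-embedding N₁-model (h₁ ∘ a) g₁ (h₁ ∘ c) h₁a⫫g₁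
      via-g₁ : ∀ {X} {x : X ⇒ _} → h₁ ∘ x ≈ g₁ ∘ x → (h₂ ∘ g₁) ∘ x ≈ (h₂ ∘ h₁) ∘ x
      via-g₁ h₁x≈g₁x = ≈-trans assoc (≈-trans (∘-congˡ h₂ (≈-sym h₁x≈g₁x)) (≈-sym assoc))
  in
  N₂ , N₂-model , h₂ ∘ h₁ , g₂ ∘ (h₁ ∘ d) ,
  [ LgtpStep-respʳ (≈-sym assoc)
      (LgtpStep-of-agreeing-embeddings ap N₁-model N₂-model M-model g₂ h₂ g₁
        (≈-sym h₂g₁≈g₂g₁) _ (λ { zero → b , via-g₁ h₁b≈g₁b ; (suc _) → c , via-g₁ h₁c≈g₁c })
        (h₁ ∘ d)) ] ,
  Ind-resp-≈ N₂-model (≈-sym assoc) (≈-sym assoc) ≈-refl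
    (Ind-monoʳ N₂-model h₂h₁a⫫g₂ (h₁ ∘ d , ≈-refl))
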